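{- Let $n\ge 5$ and let $M$ be a matching of $Q_n$. Let $u,v\in V(Q_n)$ be vertices of different parity with $uv\notin M$. If condition C1 or condition C2 holds for $u$, $v$ and $M$, then there exist vertices $z_u$ and $z_v$ of different parity such that $z_u$ is adjacent to $u$, $z_v$ is adjacent to $v$, and $z_u$ and $z_v$ are not adjacent to each other. Furthermore, there exist vertex-disjoint paths $Z_u$ and $Z_v$ in $Q_n$, where $Z_u$ connects $u$ to $z_u$ and $Z_v$ connects $v$ to $z_v$, such that $Z_u\cup Z_v$ covers all vertices of $Q_n$ and contains all edges of $M$.
   Context: $Q_n$ has vertex set $\{0,1\}^n$, two vertices adjacent iff they differ in exactly one coordinate; parity of a vertex = parity of its number of ones; $x^i$ is $x$ with coordinate $i$ flipped (edge $xx^i$ has direction $i$). A half-layer in direction $i$ is a set $\{x x^i : x_i = 0,\ x \text{ has parity } p\}$ for a fixed parity $p$; a $u$-avoiding almost half-layer in direction $i$ is $H\setminus\{uu^i\}$ where $H$ is the half-layer in direction $i$ containing $uu^i$. A vertex is covered by a set of edges if it is an endpoint of one of them. C1: $M$ contains a half-layer $H$ and both $u$ and $v$ are covered by $H$. C2: there are directions $i\ne j$ such that $v=u^i$, $M$ contains the $u$-avoiding almost half-layer in direction $i$, and $uu^j\in M$ and $vv^j\in M$. -}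

module Defs where

open import Data.Nat using (ℕ)
open import Data.Bool using (Bool; true; false; not; _xor_)
open import Data.Fin using (Fin)
open import Data.Vec using (Vec; lookup; foldr; _[_]%=_; _[_]≔_)
open import Data.List using (List; []; _∷_; head; last)
open import Data.List.Membership.Propositional using (_∈_)
open import Data.List.Relation.Unary.Linked using (Linked)
open import Data.List.Relation.Unary.Unique.Propositional using (Unique)
open import Data.Maybe using (just)
open import Data.Product using (Σ; ∃; _×_; _,_)
open import Data.Sum using (_⊎_)
open import Data.Empty using (⊥)
open import Relation.Nullary using (¬_)
open import Relation.Binary.PropositionalEquality using (_≡_; _≢_)

-- Vertices of Q_n: 0/1 vectors of length n (false = 0, true = 1).
Vertex : ℕ → Set
Vertex n = Vec Bool n

flipAt : ∀ {n} → Vertex n → Fin n → Vertex n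
flipAt x i = x [ i ]%= not

parity : ∀ {n} → Vertex n → Bool
parity = foldr _ _xor_ false

Adj : ∀ {n} → Vertex n → Vertex n → Set
Adj x y = ∃ λ i → y ≡ flipAt x i

-- A set of edges of Q_n, given by its (decidable) characteristic function on
-- ordered pairs of vertices; the edge xy belongs to M iff  M x y ≡ true.
EdgeSet : ℕ → Set
EdgeSet n = Vertex n → Vertex n → Bool

_∈E_ : ∀ {n} → (Vertex n × Vertex n) → EdgeSet n → Set
(x , y) ∈E M = M x y ≡ true

IsMatching : ∀ {n} → EdgeSet n → Set
IsMatching {n} M =
  (∀ (x y : Vertex n) → (x , y) ∈E M → (y , x) ∈E M) ×
  (∀ (x y : Vertex n) → (x , y) ∈E M → Adj x y) ×
  (∀ (x y y' : Vertex n) → (x , y) ∈E M → (x , y') ∈E M → y ≡ y')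

ContainsHalfLayer : ∀ {n} → EdgeSet n → Fin n → Bool → Set
ContainsHalfLayer {n} M i p =
  ∀ (x : Vertex n) → lookup x i ≡ false → parity x ≡ p → (x , flipAt x i) ∈E M

CoveredByHalfLayer : ∀ {n} → Fin n → Bool → Vertex n → Set
CoveredByHalfLayer {n} i p w =
  ∃ λ (x : Vertex n) → lookup x i ≡ false × parity x ≡ p × (w ≡ x ⊎ w ≡ flipAt x i)

-- The half-layer in direction i containing the edge u u^i has parity equal to
-- the parity of the endpoint of u u^i whose i-th coordinate is 0.
halfLayerParity : ∀ {n} → Vertex n → Fin n → Bool
halfLayerParity u i = parity (u [ i ]≔ false)

ContainsAvoidingAlmostHalfLayer : ∀ {n} → EdgeSet n → Vertex n → Fin n → Set
ContainsAvoidingAlmostHalfLayer {n} M u i =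
  ∀ (x : Vertex n) → lookup x i ≡ false → parity x ≡ halfLayerParity u i →
  ¬ (x ≡ u ⊎ flipAt x i ≡ u) → (x , flipAt x i) ∈E M

C1 : ∀ {n} → EdgeSet n → Vertex n → Vertex n → Set
C1 {n} M u v = Σ (Fin n) λ i → Σ Bool λ p →
  ContainsHalfLayer M i p × CoveredByHalfLayer i p u × CoveredByHalfLayer i p v

C2 : ∀ {n} → EdgeSet n → Vertex n → Vertex n → Set
C2 {n} M u v = Σ (Fin n) λ i → Σ (Fin n) λ j →
  i ≢ j × v ≡ flipAt u i × ContainsAvoidingAlmostHalfLayer M u i ×
  (u , flipAt u j) ∈E M × (v , flipAt v j) ∈E M

IsPath : ∀ {n} → List (Vertex n) → Vertex n → Vertex n → Set
IsPath P a b = Linked Adj P × Unique P × head P ≡ just a × last P ≡ just b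

data Consec {A : Set} : List A → A → A → Set where
  here  : ∀ {x y xs} → Consec (x ∷ y ∷ xs) x y
  there : ∀ {z xs x y} → Consec xs x y → Consec (z ∷ xs) x y

PathEdge : ∀ {n} → List (Vertex n) → Vertex n → Vertex n → Set
PathEdge P x y = Consec P x y ⊎ Consec P y x

{-# OPTIONS --safe #-}
-- In case C1 the half-layer forces every edge of M into direction i, since one end of
-- any other edge is already matched along i. Cut Q_n along a direction d ≠ i in which u
-- and v differ: each half is a copy of Q_(n-1), and a reflected Gray code of it with i
-- as innermost direction is a Hamiltonian path that traverses every i-edge. Start these
-- codes at u and at v and choose their first directions so that the two end points are
-- not adjacent.
-- In case C2 (v = u^i) every edge of M is an i-edge except u u^j and v v^j. A Gray code
-- of all of Q_n from v with j, i as innermost directions begins v, u, u^j, v^j; cutting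
-- off that corner leaves Z_u = u u^j and Z_v = v v^j followed by the rest of the code.
module Submission where

open import Defs
open import Data.Nat using (ℕ; _≤_; _<_)
open import Data.Nat.Properties using (<⇒≤)
open import Data.Bool using (Bool; true; false; not; _xor_)
open import Data.Bool.Properties
  using (not-involutive; not-injective; not-¬; ¬-not; not-distribˡ-xor; not-distribʳ-xor)
  renaming (_≟_ to _≟ᵇ_)
open import Data.Fin using (Fin; zero; suc; _≟_)
open import Data.Fin.Properties using (¬∀⟶∃¬; pigeonhole; <⇒≢)
open import Data.Vec using (_∷_; lookup; _[_]≔_)
open import Data.Vec.Properties
  using (lookup∘updateAt; lookup∘updateAt′; lookup∘update; updateAt-updateAt; updateAt-id-local;
         updateAt-commutes; ≡-dec)
open import Data.Vec.Relation.Binary.Pointwise.Extensional using (ext; Pointwise-≡⇒≡)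
open import Data.List as List using (List; []; _∷_; _++_; length; filter; allFin; head; last)
open import Data.List.Properties using (++-assoc; ++-identityʳ)
open import Data.List.Membership.Propositional using (_∈_; _∉_)
open import Data.List.Membership.Propositional.Properties
  using (∈-++⁺ˡ; ∈-++⁺ʳ; ∈-++⁻; ∈-filter⁺; ∈-filter⁻; ∈-allFin)
open import Data.List.Relation.Unary.Any using (here; there; any?; index)
open import Data.List.Relation.Unary.Any.Properties using (lookup-index)
open import Data.List.Relation.Unary.All using ([]; _∷_)
open import Data.List.Relation.Unary.All.Properties using (¬Any⇒All¬; All¬⇒¬Any; ++⁻ˡ; ++⁻ʳ)
open import Data.List.Relation.Unary.AllPairs using ([]; _∷_)
open import Data.List.Relation.Unary.Linked using (Linked; []; [-]; _∷_)
import Data.List.Relation.Unary.Linked.Properties as Linked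
open import Data.List.Relation.Unary.Unique.Propositional using (Unique)
import Data.List.Relation.Unary.Unique.Propositional.Properties as Unique
open import Data.List.Relation.Binary.Disjoint.Propositional using (Disjoint)
open import Data.List.Relation.Binary.Permutation.Propositional using (_↭_; ↭-sym; ↭⇒↭ₛ)
open import Data.List.Relation.Binary.Permutation.Propositional.Properties using (shifts; ∈-resp-↭)
import Data.List.Relation.Binary.Permutation.Setoid.Properties as SetoidPermutation
open import Data.Maybe using (just)
open import Data.Maybe.Relation.Binary.Connected using (Connected; just)
open import Data.Product using (Σ; ∃; _×_; _,_; proj₁; proj₂)
open import Data.Sum using (_⊎_; inj₁; inj₂; [_,_])
import Data.Sum as Sum
open import Function using (_∘_; id; flip)
open import Relation.Nullary using (¬_; Dec; yes; no; ¬?; contradiction)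
open import Relation.Nullary.Decidable using (_⊎-dec_)
open import Relation.Binary.PropositionalEquality
  using (_≡_; _≢_; refl; sym; trans; cong; subst; subst₂; setoid; module ≡-Reasoning)
open ≡-Reasoning

private variable
  A : Set
  n : ℕ
  u v x y z : Vertex n
  d i j k l : Fin n
  p : Bool
  xs ys : List A
  M : EdgeSet n

PathCover : EdgeSet n → List (Vertex n) → List (Vertex n) → Set
PathCover {n} M Zu Zv =
  (∀ w → w ∈ Zu → ¬ (w ∈ Zv)) × (∀ (w : Vertex n) → w ∈ Zu ⊎ w ∈ Zv) ×
  (∀ x y → (x , y) ∈E M → PathEdge Zu x y ⊎ PathEdge Zv x y)

SpanningPathPair : EdgeSet n → Vertex n → Vertex n → Set
SpanningPathPair {n} M u v =
  Σ (Vertex n) λ zu → Σ (Vertex n) λ zv →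
    parity zu ≢ parity zv × Adj u zu × Adj v zv × ¬ Adj zu zv ×
    Σ (List (Vertex n)) λ Zu → Σ (List (Vertex n)) λ Zv →
      IsPath Zu u zu × IsPath Zv v zv × PathCover M Zu Zv

_≟ᵥ_ : (x y : Vertex n) → Dec (x ≡ y)
_≟ᵥ_ = ≡-dec _≟ᵇ_

lookup-flipAt : (x : Vertex n) (i : Fin n) → lookup (flipAt x i) i ≡ not (lookup x i)
lookup-flipAt x i = lookup∘updateAt i x

lookup-flipAt-≢ : (x : Vertex n) → i ≢ k → lookup (flipAt x i) k ≡ lookup x k
lookup-flipAt-≢ {i = i} {k} x i≢k = lookup∘updateAt′ k i (i≢k ∘ sym) x

flipAt-involutive : (x : Vertex n) (i : Fin n) → flipAt (flipAt x i) i ≡ x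
flipAt-involutive x i =
  trans (updateAt-updateAt i x) (updateAt-id-local i x (not-involutive (lookup x i)))

flipAt-comm : (x : Vertex n) (i j : Fin n) → flipAt (flipAt x i) j ≡ flipAt (flipAt x j) i
flipAt-comm x i j with i ≟ j
... | yes refl = refl
... | no i≢j   = updateAt-commutes j i (i≢j ∘ sym) x

flipAt-swap : x ≡ flipAt y i → y ≡ flipAt x i
flipAt-swap {y = y} {i = i} refl = sym (flipAt-involutive y i)

flipAt-≢ : (x : Vertex n) → i ≢ j → flipAt x i ≢ flipAt x j
flipAt-≢ {i = i} {j} x i≢j xⁱ≡xʲ = not-¬ refl (begin
  lookup x i             ≡⟨ lookup-flipAt-≢ x (i≢j ∘ sym) ⟨
  lookup (flipAt x j) i  ≡⟨ cong (λ y → lookup y i) xⁱ≡xʲ ⟨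
  lookup (flipAt x i) i  ≡⟨ lookup-flipAt x i ⟩
  not (lookup x i)       ∎)

parity-flipAt : (x : Vertex n) (i : Fin n) → parity (flipAt x i) ≡ not (parity x)
parity-flipAt (c ∷ x) zero    = sym (not-distribˡ-xor c (parity x))
parity-flipAt (c ∷ x) (suc i) =
  trans (cong (c xor_) (parity-flipAt x i)) (sym (not-distribʳ-xor c (parity x)))

parity-flipAt-≢ : (x y : Vertex n) → parity x ≢ parity y → (i j : Fin n) →
                  parity (flipAt x i) ≢ parity (flipAt y j)
parity-flipAt-≢ x y px≢py i j eq =
  px≢py (not-injective (trans (sym (parity-flipAt x i)) (trans eq (parity-flipAt y j))))

Adj⇒parity-≢ : Adj x y → parity x ≢ parity y
Adj⇒parity-≢ {x = x} (i , refl) eq = not-¬ refl (trans eq (parity-flipAt x i))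

Adj-differsAt⇒≡flipAt : Adj x y → lookup x k ≢ lookup y k → y ≡ flipAt x k
Adj-differsAt⇒≡flipAt {x = x} {k = k} (i , refl) differs with i ≟ k
... | yes refl = refl
... | no i≢k   = contradiction (sym (lookup-flipAt-≢ x i≢k)) differs

¬Adj-differsAt₂ : k ≢ l → lookup x k ≢ lookup y k → lookup x l ≢ lookup y l → ¬ Adj x y
¬Adj-differsAt₂ {x = x} k≢l differsₖ differsₗ adj with Adj-differsAt⇒≡flipAt adj differsₖ
... | refl = differsₗ (sym (lookup-flipAt-≢ x k≢l))

Adj-flipAt⁻ : (c : Fin n) → Adj (flipAt x c) (flipAt y c) → Adj x y
Adj-flipAt⁻ {x = x} {y} c (k , eq) = k , (begin
  y                                  ≡⟨ flipAt-involutive y c ⟨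
  flipAt (flipAt y c) c              ≡⟨ cong (λ z → flipAt z c) eq ⟩
  flipAt (flipAt (flipAt x c) k) c   ≡⟨ flipAt-comm (flipAt x c) k c ⟩
  flipAt (flipAt (flipAt x c) c) k   ≡⟨ cong (λ z → flipAt z k) (flipAt-involutive x c) ⟩
  flipAt x k                         ∎)

¬Adj-flipAt-flipAt² : (x : Vertex n) → i ≢ j → i ≢ k → j ≢ k →
                      ¬ Adj (flipAt x i) (flipAt (flipAt x j) k)
¬Adj-flipAt-flipAt² {i = i} {j} {k} x i≢j i≢k j≢k = ¬Adj-differsAt₂ j≢k differsAtⱼ differsAtₖ
  where
  differsAtⱼ : lookup (flipAt x i) j ≢ lookup (flipAt (flipAt x j) k) j
  differsAtⱼ eq = not-¬ refl (begin
    lookup x j                            ≡⟨ lookup-flipAt-≢ x i≢j ⟨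
    lookup (flipAt x i) j                 ≡⟨ eq ⟩
    lookup (flipAt (flipAt x j) k) j      ≡⟨ lookup-flipAt-≢ (flipAt x j) (j≢k ∘ sym) ⟩
    lookup (flipAt x j) j                 ≡⟨ lookup-flipAt x j ⟩
    not (lookup x j)                      ∎)
  differsAtₖ : lookup (flipAt x i) k ≢ lookup (flipAt (flipAt x j) k) k
  differsAtₖ eq = not-¬ refl (begin
    lookup x k                            ≡⟨ lookup-flipAt-≢ x i≢k ⟨
    lookup (flipAt x i) k                 ≡⟨ eq ⟩
    lookup (flipAt (flipAt x j) k) k      ≡⟨ lookup-flipAt (flipAt x j) k ⟩
    not (lookup (flipAt x j) k)           ≡⟨ cong not (lookup-flipAt-≢ x j≢k) ⟩
    not (lookup x k)                      ∎)

agreeOutside⇒≡⊎≡flipAt : (i : Fin n) → (∀ k → k ≢ i → lookup x k ≡ lookup y k) →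
                         y ≡ x ⊎ y ≡ flipAt x i
agreeOutside⇒≡⊎≡flipAt {x = x} {y} i agree with lookup x i ≟ᵇ lookup y i
... | yes same = inj₁ (sym (Pointwise-≡⇒≡ (ext agreeEverywhere)))
  where
  agreeEverywhere : ∀ k → lookup x k ≡ lookup y k
  agreeEverywhere k with k ≟ i
  ... | yes refl = same
  ... | no k≢i   = agree k k≢i
... | no differs = inj₂ (Pointwise-≡⇒≡ (ext agreeWithFlip))
  where
  agreeWithFlip : ∀ k → lookup y k ≡ lookup (flipAt x i) k
  agreeWithFlip k with k ≟ i
  ... | yes refl = trans (¬-not (differs ∘ sym)) (sym (lookup-flipAt x i))
  ... | no k≢i   = trans (sym (agree k k≢i)) (sym (lookup-flipAt-≢ x (k≢i ∘ sym)))

differingDirection : (i : Fin n) → parity u ≢ parity v → v ≢ flipAt u i →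
                     ∃ λ d → d ≢ i × lookup u d ≢ lookup v d
differingDirection {n = n} {u} {v} i pu≢pv v≢uⁱ with ¬∀⟶∃¬ n SameOrI sameOrI? notAll
  where
  SameOrI : Fin n → Set
  SameOrI k = k ≡ i ⊎ lookup u k ≡ lookup v k
  sameOrI? : ∀ k → Dec (SameOrI k)
  sameOrI? k = (k ≟ i) ⊎-dec (lookup u k ≟ᵇ lookup v k)
  notAll : ¬ (∀ k → SameOrI k)
  notAll all with agreeOutside⇒≡⊎≡flipAt i (λ k k≢i → [ flip contradiction k≢i , id ] (all k))
  ... | inj₁ v≡u  = pu≢pv (cong parity (sym v≡u))
  ... | inj₂ v≡uⁱ = v≢uⁱ v≡uⁱ
... | d , ¬sameOrI = d , ¬sameOrI ∘ inj₁ , ¬sameOrI ∘ inj₂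

Unique-++⁻ : (xs : List A) → Unique (xs ++ ys) → Unique xs × Unique ys × Disjoint xs ys
Unique-++⁻ []       unique = [] , unique , λ ()
Unique-++⁻ (x ∷ xs) (x∉ ∷ unique) with Unique-++⁻ xs unique
... | uniqueˡ , uniqueʳ , disjoint = ++⁻ˡ xs x∉ ∷ uniqueˡ , uniqueʳ , λ where
  (here refl , x∈ys)  → All¬⇒¬Any (++⁻ʳ xs x∉) x∈ys
  (there y∈xs , y∈ys) → disjoint (y∈xs , y∈ys)

Unique-swap : {x y : A} → Unique (x ∷ y ∷ xs) → Unique (y ∷ x ∷ xs)
Unique-swap ((x≢y ∷ x∉) ∷ y∉ ∷ unique) = ((x≢y ∘ sym) ∷ y∉) ∷ x∉ ∷ unique

_∈?_ : (k : Fin n) (ks : List (Fin n)) → Dec (k ∈ ks)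
k ∈? ks = any? (k ≟_) ks

fresh : (ks : List (Fin n)) → Unique ks → length ks < n → ∃ λ k → Unique (k ∷ ks)
fresh {n = n} ks unique len<n with ¬∀⟶∃¬ n (_∈ ks) (_∈? ks) notAll
  where
  notAll : ¬ (∀ k → k ∈ ks)
  notAll all with pigeonhole len<n (λ k → index (all k))
  ... | k , l , k<l , sameIndex = <⇒≢ k<l (begin
    k                               ≡⟨ lookup-index (all k) ⟩
    List.lookup ks (index (all k))  ≡⟨ cong (List.lookup ks) sameIndex ⟩
    List.lookup ks (index (all l))  ≡⟨ lookup-index (all l) ⟨
    l                               ∎)
... | k , k∉ks = k , ¬Any⇒All¬ ks k∉ks ∷ unique

others : List (Fin n) → List (Fin n)
others ks = filter (λ k → ¬? (k ∈? ks)) (allFin _)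

∈-others : {ks : List (Fin n)} → k ∉ ks → k ∈ others ks
∈-others {k = k} {ks} k∉ks = ∈-filter⁺ (λ k → ¬? (k ∈? ks)) (∈-allFin k) k∉ks

∈-others⁻ : {ks : List (Fin n)} → k ∈ others ks → k ∉ ks
∈-others⁻ {n = n} {ks = ks} k∈ = proj₂ (∈-filter⁻ (λ k → ¬? (k ∈? ks)) {xs = allFin n} k∈)

others-unique : (ks : List (Fin n)) → Unique (others ks)
others-unique {n = n} ks = Unique.filter⁺ (λ k → ¬? (k ∈? ks)) (Unique.allFin⁺ n)

AllDirectionsExcept : List (Fin n) → List (Fin n) → Set
AllDirectionsExcept X L = Unique L × (∀ k → k ∈ L ⊎ k ∈ X) × (∀ k → k ∈ X → k ∉ L)

arrange : (X P S : List (Fin n)) → List (Fin n)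
arrange X P S = P ++ others ((P ++ S) ++ X) ++ S

arrange-allDirectionsExcept : (X P S : List (Fin n)) → Unique ((P ++ S) ++ X) →
                              AllDirectionsExcept X (arrange X P S)
arrange-allDirectionsExcept {n = n} X P S unique = unique′ , complete , avoids
  where
  R : List (Fin n)
  R = others ((P ++ S) ++ X)
  uniquePS : Unique (P ++ S)
  uniquePS = proj₁ (Unique-++⁻ (P ++ S) unique)
  disjointPS : Disjoint (P ++ S) X
  disjointPS = proj₂ (proj₂ (Unique-++⁻ (P ++ S) unique))
  shuffle : P ++ R ++ S ↭ R ++ P ++ S
  shuffle = shifts P R
  unique′ : Unique (P ++ R ++ S)
  unique′ = SetoidPermutation.Unique-resp-↭ (setoid (Fin n)) (↭⇒↭ₛ (↭-sym shuffle))
    (Unique.++⁺ (others-unique _) uniquePS (λ (k∈R , k∈PS) → ∈-others⁻ k∈R (∈-++⁺ˡ k∈PS)))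
  complete : ∀ k → k ∈ P ++ R ++ S ⊎ k ∈ X
  complete k with k ∈? ((P ++ S) ++ X)
  ... | no k∉ = inj₁ (∈-resp-↭ (↭-sym shuffle) (∈-++⁺ˡ (∈-others k∉)))
  ... | yes k∈ with ∈-++⁻ (P ++ S) k∈
  ...   | inj₁ k∈PS = inj₁ (∈-resp-↭ (↭-sym shuffle) (∈-++⁺ʳ R k∈PS))
  ...   | inj₂ k∈X  = inj₂ k∈X
  avoids : ∀ k → k ∈ X → k ∉ P ++ R ++ S
  avoids k k∈X k∈ with ∈-++⁻ R (∈-resp-↭ shuffle k∈)
  ... | inj₁ k∈R  = ∈-others⁻ k∈R (∈-++⁺ʳ (P ++ S) k∈X)
  ... | inj₂ k∈PS = disjointPS (k∈PS , k∈X)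

-- Reflected Gray codes

last-++-∷ : (xs : List A) {y : A} {ys : List A} → last (xs ++ y ∷ ys) ≡ last (y ∷ ys)
last-++-∷ []            = refl
last-++-∷ (x ∷ [])      = refl
last-++-∷ (x ∷ x′ ∷ xs) = last-++-∷ (x′ ∷ xs)

Consec-++⁺ˡ : {xs : List A} (ys : List A) {x y : A} → Consec xs x y → Consec (xs ++ ys) x y
Consec-++⁺ˡ ys here      = here
Consec-++⁺ˡ ys (there c) = there (Consec-++⁺ˡ ys c)

Consec-++⁺ʳ : (xs : List A) {ys : List A} {x y : A} → Consec ys x y → Consec (xs ++ ys) x y
Consec-++⁺ʳ []       c = c
Consec-++⁺ʳ (z ∷ xs) c = there (Consec-++⁺ʳ xs c)

Consec-++⁻ʳ : (xs : List A) {ys : List A} {x y : A} →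
              Consec (xs ++ ys) x y → x ∉ xs → Consec ys x y
Consec-++⁻ʳ []            c         _  = c
Consec-++⁻ʳ (z ∷ [])      here      x∉ = contradiction (here refl) x∉
Consec-++⁻ʳ (z ∷ [])      (there c) _  = c
Consec-++⁻ʳ (z ∷ z′ ∷ xs) here      x∉ = contradiction (here refl) x∉
Consec-++⁻ʳ (z ∷ z′ ∷ xs) (there c) x∉ = Consec-++⁻ʳ (z′ ∷ xs) c (x∉ ∘ there)

PathEdge-++⁺ˡ : {xs : List (Vertex n)} (ys : List (Vertex n)) →
                PathEdge xs x y → PathEdge (xs ++ ys) x y
PathEdge-++⁺ˡ ys = Sum.map (Consec-++⁺ˡ ys) (Consec-++⁺ˡ ys)

PathEdge-++⁺ʳ : (xs : List (Vertex n)) {ys : List (Vertex n)} →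
                PathEdge ys x y → PathEdge (xs ++ ys) x y
PathEdge-++⁺ʳ xs = Sum.map (Consec-++⁺ʳ xs) (Consec-++⁺ʳ xs)

SameOutside : List (Fin n) → Vertex n → Vertex n → Set
SameOutside L x y = ∀ k → k ∉ L → lookup x k ≡ lookup y k

sameOutside-∷⁻ : {L : List (Fin n)} → (d ∉ L → lookup x d ≡ lookup y d) →
                 SameOutside (d ∷ L) x y → SameOutside L x y
sameOutside-∷⁻ {d = d} sameAtD same k k∉L with k ≟ d
... | yes refl = sameAtD k∉L
... | no k≢d   = same k λ where
  (here k≡d)  → k≢d k≡d
  (there k∈L) → k∉L k∈L

grayEnd : Vertex n → List (Fin n) → Vertex n
grayEnd a []      = a
grayEnd a (d ∷ _) = flipAt a d

grayTurn : Vertex n → Fin n → List (Fin n) → Vertex n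
grayTurn a d L = flipAt (grayEnd a L) d

-- Its second half, the first
-- half shifted along d and reversed, is again a Gray code along L, started at its own
-- first vertex: the d-neighbour of the end of the first half.
gray : Vertex n → List (Fin n) → List (Vertex n)
gray a []      = a ∷ []
gray a (d ∷ L) = gray a L ++ gray (grayTurn a d L) L

grayEnd-grayTurn : (a : Vertex n) (d : Fin n) (L : List (Fin n)) →
                   grayEnd (grayTurn a d L) L ≡ flipAt a d
grayEnd-grayTurn a d []      = refl
grayEnd-grayTurn a d (e ∷ L) = begin
  flipAt (flipAt (flipAt a e) d) e   ≡⟨ flipAt-comm (flipAt a e) d e ⟩
  flipAt (flipAt (flipAt a e) e) d   ≡⟨ cong (λ z → flipAt z d) (flipAt-involutive a e) ⟩
  flipAt a d                         ∎

grayEnd-sameOutside : (a : Vertex n) (L : List (Fin n)) → SameOutside L (grayEnd a L) a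
grayEnd-sameOutside a []      k _   = refl
grayEnd-sameOutside a (d ∷ L) k k∉ = lookup-flipAt-≢ a (λ d≡k → k∉ (here (sym d≡k)))

grayTurn-sameOutside : (a : Vertex n) (L : List (Fin n)) →
                       SameOutside (d ∷ L) (grayTurn a d L) a
grayTurn-sameOutside a L k k∉ =
  trans (lookup-flipAt-≢ (grayEnd a L) (λ d≡k → k∉ (here (sym d≡k))))
        (grayEnd-sameOutside a L k (k∉ ∘ there))

lookup-grayTurn : (a : Vertex n) {L : List (Fin n)} → d ∉ L →
                  lookup (grayTurn a d L) d ≡ not (lookup a d)
lookup-grayTurn {d = d} a {L} d∉L =
  trans (lookup-flipAt (grayEnd a L) d) (cong not (grayEnd-sameOutside a L d d∉L))

gray-∷ : (a : Vertex n) (L : List (Fin n)) → ∃ λ T → gray a L ≡ a ∷ T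
gray-∷ a []      = [] , refl
gray-∷ a (d ∷ L) with gray-∷ a L
... | T , eq = T ++ gray (grayTurn a d L) L , cong (_++ gray (grayTurn a d L) L) eq

head-gray : (a : Vertex n) (L : List (Fin n)) → head (gray a L) ≡ just a
head-gray a L = cong head (proj₂ (gray-∷ a L))

last-gray : (a : Vertex n) (L : List (Fin n)) → last (gray a L) ≡ just (grayEnd a L)
last-gray a []      = refl
last-gray a (d ∷ L) = begin
  last (gray a L ++ gray b L)      ≡⟨ cong (λ Z → last (gray a L ++ Z)) (proj₂ (gray-∷ b L)) ⟩
  last (gray a L ++ b ∷ T)         ≡⟨ last-++-∷ (gray a L) ⟩
  last (b ∷ T)                     ≡⟨ cong last (proj₂ (gray-∷ b L)) ⟨
  last (gray b L)                  ≡⟨ last-gray b L ⟩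
  just (grayEnd b L)               ≡⟨ cong just (grayEnd-grayTurn a d L) ⟩
  just (flipAt a d)                ∎
  where
  b : Vertex _
  b = grayTurn a d L
  T : List (Vertex _)
  T = proj₁ (gray-∷ b L)

gray-linked : (a : Vertex n) (L : List (Fin n)) → Linked Adj (gray a L)
gray-linked a []      = [-]
gray-linked a (d ∷ L) = Linked.++⁺ (gray-linked a L) junction (gray-linked b L)
  where
  b : Vertex _
  b = grayTurn a d L
  junction : Connected Adj (last (gray a L)) (head (gray b L))
  junction = subst₂ (Connected Adj) (sym (last-gray a L)) (sym (head-gray b L)) (just (d , refl))

∈-gray⁻ : (a : Vertex n) (L : List (Fin n)) → x ∈ gray a L → SameOutside L x a
∈-gray⁻ a []      (here refl) k _ = refl
∈-gray⁻ a (d ∷ L) x∈ k k∉ with ∈-++⁻ (gray a L) x∈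
... | inj₁ x∈₁ = ∈-gray⁻ a L x∈₁ k (k∉ ∘ there)
... | inj₂ x∈₂ = trans (∈-gray⁻ (grayTurn a d L) L x∈₂ k (k∉ ∘ there))
                       (grayTurn-sameOutside a L k k∉)

∈-gray⁺ : (a : Vertex n) (L : List (Fin n)) → SameOutside L x a → x ∈ gray a L
∈-gray⁺ a []      same = here (Pointwise-≡⇒≡ (ext λ k → same k λ ()))
∈-gray⁺ {x = x} a (d ∷ L) same with lookup x d ≟ᵇ lookup a d
... | yes sameAtD =
  ∈-++⁺ˡ (∈-gray⁺ a L (sameOutside-∷⁻ {x = x} {y = a} (λ _ → sameAtD) same))
... | no differsAtD =
  ∈-++⁺ʳ (gray a L) (∈-gray⁺ b L (sameOutside-∷⁻ {x = x} {y = b} sameAtD sameAsB))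
  where
  b : Vertex _
  b = grayTurn a d L
  sameAtD : d ∉ L → lookup x d ≡ lookup b d
  sameAtD d∉L = trans (¬-not differsAtD) (sym (lookup-grayTurn a d∉L))
  sameAsB : SameOutside (d ∷ L) x b
  sameAsB k k∉ = trans (same k k∉) (sym (grayTurn-sameOutside a L k k∉))

gray-unique : (a : Vertex n) {L : List (Fin n)} → Unique L → Unique (gray a L)
gray-unique a {[]}    _ = [] ∷ []
gray-unique a {d ∷ L} (d∉ ∷ unique) =
  Unique.++⁺ (gray-unique a unique) (gray-unique b unique) λ {x} (x∈₁ , x∈₂) → not-¬ refl (begin
    lookup a d  ≡⟨ ∈-gray⁻ a L x∈₁ d d∉L ⟨
    lookup x d  ≡⟨ ∈-gray⁻ b L x∈₂ d d∉L ⟩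
    lookup b d  ≡⟨ lookup-grayTurn a d∉L ⟩
    not (lookup a d) ∎)
  where
  b : Vertex _
  b = grayTurn a d L
  d∉L : d ∉ L
  d∉L = All¬⇒¬Any d∉

gray-isPath : (a : Vertex n) {L : List (Fin n)} → Unique (d ∷ L) →
              IsPath (gray a (d ∷ L)) a (flipAt a d)
gray-isPath {d = d} a {L} unique =
  gray-linked a (d ∷ L) , gray-unique a unique , head-gray a (d ∷ L) , last-gray a (d ∷ L)

gray-++ : (a : Vertex n) (K L : List (Fin n)) → ∃ λ T → gray a (K ++ L) ≡ gray a L ++ T
gray-++ a []      L = [] , sym (++-identityʳ (gray a L))
gray-++ a (d ∷ K) L with gray-++ a K L
... | T , eq = T ++ R , (begin
  gray a (K ++ L) ++ R    ≡⟨ cong (_++ R) eq ⟩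
  (gray a L ++ T) ++ R    ≡⟨ ++-assoc (gray a L) T R ⟩
  gray a L ++ T ++ R      ∎)
  where
  R : List (Vertex _)
  R = gray (grayTurn a d (K ++ L)) (K ++ L)

gray-square : {a b : Vertex n} → b ≡ flipAt a i → (j : Fin n) →
              gray a (j ∷ i ∷ []) ≡ a ∷ b ∷ flipAt b j ∷ flipAt a j ∷ []
gray-square {i = i} {a} refl j =
  cong (λ z → a ∷ flipAt a i ∷ flipAt (flipAt a i) j ∷ z ∷ []) (grayEnd-grayTurn a j (i ∷ []))

gray-pathEdge : (a : Vertex n) (K : List (Fin n)) (i : Fin n) →
                x ∈ gray a (K ++ i ∷ []) → PathEdge (gray a (K ++ i ∷ [])) x (flipAt x i)
gray-pathEdge a []      i (here refl)         = inj₁ here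
gray-pathEdge a []      i (there (here refl)) =
  inj₂ (subst (λ z → Consec (a ∷ flipAt a i ∷ []) z (flipAt a i))
              (sym (flipAt-involutive a i)) here)
gray-pathEdge a (d ∷ K) i x∈ with ∈-++⁻ (gray a (K ++ i ∷ [])) x∈
... | inj₁ x∈₁ = PathEdge-++⁺ˡ _ (gray-pathEdge a K i x∈₁)
... | inj₂ x∈₂ = PathEdge-++⁺ʳ (gray a (K ++ i ∷ [])) (gray-pathEdge _ K i x∈₂)

-- Matchings and half-layers

halfLayerParity-flipAt : (x : Vertex n) → k ≢ i →
                         halfLayerParity (flipAt x k) i ≡ not (halfLayerParity x i)
halfLayerParity-flipAt {k = k} {i} x k≢i =
  trans (cong parity (updateAt-commutes i k (k≢i ∘ sym) x)) (parity-flipAt (x [ i ]≔ false) k)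

halfLayerParity-split : (x : Vertex n) (p : Bool) → k ≢ i →
                        halfLayerParity x i ≡ p ⊎ halfLayerParity (flipAt x k) i ≡ p
halfLayerParity-split {i = i} x p k≢i with halfLayerParity x i ≟ᵇ p
... | yes same  = inj₁ same
... | no differ =
  inj₂ (trans (halfLayerParity-flipAt x k≢i) (trans (cong not (¬-not differ)) (not-involutive p)))

halfLayerParity-covered : (x : Vertex n) (i : Fin n) → CoveredByHalfLayer i (halfLayerParity x i) x
halfLayerParity-covered x i = x [ i ]≔ false , lookup∘update i x false , refl , lowerOrUpper
  where
  lowerOrUpper : x ≡ x [ i ]≔ false ⊎ x ≡ flipAt (x [ i ]≔ false) i
  lowerOrUpper with lookup x i in xᵢ
  ... | false = inj₁ (sym (updateAt-id-local i x (sym xᵢ)))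
  ... | true  = inj₂ (sym (trans (updateAt-updateAt i x) (updateAt-id-local i x (sym xᵢ))))

module Matching {M : EdgeSet n} (isMatching : IsMatching M) where

  M-sym : (x , y) ∈E M → (y , x) ∈E M
  M-sym = proj₁ isMatching _ _

  M-adj : (x , y) ∈E M → Adj x y
  M-adj = proj₁ (proj₂ isMatching) _ _

  M-functional : (x , y) ∈E M → (x , z) ∈E M → y ≡ z
  M-functional = proj₂ (proj₂ isMatching) _ _ _

  matchedAlong-endpoint : (y , flipAt y i) ∈E M → x ≡ y ⊎ x ≡ flipAt y i → (x , flipAt x i) ∈E M
  matchedAlong-endpoint yyⁱ∈M (inj₁ refl) = yyⁱ∈M
  matchedAlong-endpoint {y = y} {i} yyⁱ∈M (inj₂ refl) =
    subst (λ z → (flipAt y i , z) ∈E M) (sym (flipAt-involutive y i)) (M-sym yyⁱ∈M)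

  matched-along : (x , y) ∈E M → (x , flipAt x i) ∈E M ⊎ (y , flipAt y i) ∈E M → y ≡ flipAt x i
  matched-along xy∈M (inj₁ xxⁱ∈M) = M-functional xy∈M xxⁱ∈M
  matched-along xy∈M (inj₂ yyⁱ∈M) = flipAt-swap (M-functional (M-sym xy∈M) yyⁱ∈M)

  edge-split : (p : Bool) → (x , y) ∈E M →
               y ≡ flipAt x i ⊎ halfLayerParity x i ≡ p ⊎ halfLayerParity y i ≡ p
  edge-split {x = x} {i = i} p xy∈M with M-adj xy∈M
  ... | k , refl with k ≟ i
  ...   | yes refl = inj₁ refl
  ...   | no k≢i   = inj₂ (halfLayerParity-split x p k≢i)

  halfLayer-covered : ContainsHalfLayer M i p → CoveredByHalfLayer i p x → (x , flipAt x i) ∈E M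
  halfLayer-covered H (y , yᵢ≡0 , py , x≡y⊎yⁱ) = matchedAlong-endpoint (H y yᵢ≡0 py) x≡y⊎yⁱ

  halfLayer-matched : ContainsHalfLayer M i p → halfLayerParity x i ≡ p → (x , flipAt x i) ∈E M
  halfLayer-matched {i = i} {x = x} H refl = halfLayer-covered H (halfLayerParity-covered x i)

  halfLayer-edge : ContainsHalfLayer M i p → (x , y) ∈E M → y ≡ flipAt x i
  halfLayer-edge {p = p} H xy∈M with edge-split p xy∈M
  ... | inj₁ y≡xⁱ      = y≡xⁱ
  ... | inj₂ (inj₁ px) = matched-along xy∈M (inj₁ (halfLayer-matched H px))
  ... | inj₂ (inj₂ py) = matched-along xy∈M (inj₂ (halfLayer-matched H py))

  almostHalfLayer-matched : ContainsAvoidingAlmostHalfLayer M u i →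
                            halfLayerParity x i ≡ halfLayerParity u i → x ∉ u ∷ flipAt u i ∷ [] →
                            (x , flipAt x i) ∈E M
  almostHalfLayer-matched {u = u} {i} {x} A px≡pu x∉ with halfLayerParity-covered x i
  ... | y , yᵢ≡0 , py , x≡y⊎yⁱ =
    matchedAlong-endpoint (A y yᵢ≡0 (trans py px≡pu) (avoidsU x≡y⊎yⁱ)) x≡y⊎yⁱ
    where
    avoidsU : x ≡ y ⊎ x ≡ flipAt y i → ¬ (y ≡ u ⊎ flipAt y i ≡ u)
    avoidsU (inj₁ refl) (inj₁ x≡u)  = x∉ (here x≡u)
    avoidsU (inj₁ refl) (inj₂ xⁱ≡u) = x∉ (there (here (flipAt-swap (sym xⁱ≡u))))
    avoidsU (inj₂ refl) (inj₁ refl) = x∉ (there (here refl))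
    avoidsU (inj₂ refl) (inj₂ x≡u)  = x∉ (here x≡u)

  almostHalfLayer-edge : ContainsAvoidingAlmostHalfLayer M u i → (x , y) ∈E M →
                         x ∉ u ∷ flipAt u i ∷ [] → y ∉ u ∷ flipAt u i ∷ [] → y ≡ flipAt x i
  almostHalfLayer-edge {u = u} {i} A xy∈M x∉ y∉ with edge-split (halfLayerParity u i) xy∈M
  ... | inj₁ y≡xⁱ      = y≡xⁱ
  ... | inj₂ (inj₁ px) = matched-along xy∈M (inj₁ (almostHalfLayer-matched A px x∉))
  ... | inj₂ (inj₂ py) = matched-along xy∈M (inj₂ (almostHalfLayer-matched A py y∉))

-- Case C1

∉E-≢ : M u v ≡ false → (u , z) ∈E M → v ≢ z
∉E-≢ uv∉M uz∈M refl with trans (sym uv∉M) uz∈M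
... | ()

∈-gray-facet : {L : List (Fin n)} → AllDirectionsExcept (d ∷ []) L → (a : Vertex n) →
               lookup x d ≡ lookup a d → x ∈ gray a L
∈-gray-facet {d = d} {x = x} {L} (_ , complete , _) a sameAtD = ∈-gray⁺ a L sameOutside
  where
  sameOutside : SameOutside L x a
  sameOutside k k∉L with complete k
  ... | inj₁ k∈L         = contradiction k∈L k∉L
  ... | inj₂ (here refl) = sameAtD

lookup-gray-facet : {L : List (Fin n)} → AllDirectionsExcept (d ∷ []) L → (a : Vertex n) →
                    x ∈ gray a L → lookup x d ≡ lookup a d
lookup-gray-facet {d = d} {L = L} (_ , _ , avoids) a x∈ = ∈-gray⁻ a L x∈ d (avoids d (here refl))

facetPaths : (∀ {x y} → (x , y) ∈E M → y ≡ flipAt x i) →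
             parity u ≢ parity v → lookup u d ≢ lookup v d →
             (c : Fin n) (Ku : List (Fin n)) (c′ : Fin n) (Kv : List (Fin n)) →
             AllDirectionsExcept (d ∷ []) (c ∷ Ku ++ i ∷ []) →
             AllDirectionsExcept (d ∷ []) (c′ ∷ Kv ++ i ∷ []) →
             ¬ Adj (flipAt u c) (flipAt v c′) → SpanningPathPair M u v
facetPaths {M = M} {i = i} {u = u} {v = v} {d = d} alongI pu≢pv ud≢vd c Ku c′ Kv okU okV ¬adj =
  flipAt u c , flipAt v c′ , parity-flipAt-≢ u v pu≢pv c c′ , (c , refl) , (c′ , refl) , ¬adj ,
  Zu , Zv , gray-isPath u (proj₁ okU) , gray-isPath v (proj₁ okV) , disjoint , cover , edges
  where
  Zu : List (Vertex _)
  Zu = gray u (c ∷ Ku ++ i ∷ [])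
  Zv : List (Vertex _)
  Zv = gray v (c′ ∷ Kv ++ i ∷ [])
  disjoint : ∀ w → w ∈ Zu → w ∉ Zv
  disjoint w w∈Zu w∈Zv =
    ud≢vd (trans (sym (lookup-gray-facet okU u w∈Zu)) (lookup-gray-facet okV v w∈Zv))
  cover : ∀ w → w ∈ Zu ⊎ w ∈ Zv
  cover w with lookup w d ≟ᵇ lookup u d
  ... | yes same  = inj₁ (∈-gray-facet okU u same)
  ... | no differ = inj₂ (∈-gray-facet okV v (trans (¬-not differ) (sym (¬-not (ud≢vd ∘ sym)))))
  edges : ∀ x y → (x , y) ∈E M → PathEdge Zu x y ⊎ PathEdge Zv x y
  edges x y xy∈M with alongI xy∈M
  ... | refl = Sum.map (gray-pathEdge u (c ∷ Ku) i) (gray-pathEdge v (c′ ∷ Kv) i) (cover x)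

halfLayer⇒spanningPathPair : {M : EdgeSet n} {u v : Vertex n} → 4 ≤ n → IsMatching M →
                             parity u ≢ parity v → M u v ≡ false →
                             ContainsHalfLayer M i p → CoveredByHalfLayer i p u → SpanningPathPair M u v
halfLayer⇒spanningPathPair {n = n} {i = i} {M = M} {u} {v} 4≤n isMatching pu≢pv uv∉M H u-covered
  with differingDirection {u = u} {v} i pu≢pv
         (∉E-≢ {M = M} uv∉M (Matching.halfLayer-covered isMatching H u-covered))
... | d , d≢i , ud≢vd with fresh (i ∷ d ∷ []) (((d≢i ∘ sym) ∷ []) ∷ [] ∷ []) (<⇒≤ 4≤n)
... | a , unique-aid with fresh (a ∷ i ∷ d ∷ []) unique-aid 4≤n
... | b , unique-baid@((b≢a ∷ _ ∷ b≢d ∷ []) ∷ (_ ∷ a≢d ∷ []) ∷ _) = pathsFor (v ≟ᵥ flipAt u d)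
  where
  paths : (c c′ : Fin n) → Unique (c ∷ c′ ∷ i ∷ d ∷ []) →
          (e e′ : Fin n) → Unique (e ∷ e′ ∷ i ∷ d ∷ []) →
          ¬ Adj (flipAt u c) (flipAt v e) → SpanningPathPair M u v
  paths c c′ uniqueU e e′ uniqueV = facetPaths (Matching.halfLayer-edge isMatching H) pu≢pv ud≢vd
    c (c′ ∷ others (c ∷ c′ ∷ i ∷ d ∷ [])) e (e′ ∷ others (e ∷ e′ ∷ i ∷ d ∷ []))
    (arrange-allDirectionsExcept (d ∷ []) (c ∷ c′ ∷ []) (i ∷ []) uniqueU)
    (arrange-allDirectionsExcept (d ∷ []) (e ∷ e′ ∷ []) (i ∷ []) uniqueV)
  -- If v = u^d the ends u^a, v^b differ in a, b and d; otherwise u^b, v^b differ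
  -- wherever u and v do, which is at d and somewhere else.
  pathsFor : Dec (v ≡ flipAt u d) → SpanningPathPair M u v
  pathsFor (yes v≡uᵈ) = paths a b (Unique-swap unique-baid) b a unique-baid
    (subst (λ w → ¬ Adj (flipAt u a) (flipAt w b)) (sym v≡uᵈ)
      (¬Adj-flipAt-flipAt² u a≢d (b≢a ∘ sym) (b≢d ∘ sym)))
  pathsFor (no v≢uᵈ)  = paths b a unique-baid b a unique-baid
    (λ adj → v≢uᵈ (Adj-differsAt⇒≡flipAt (Adj-flipAt⁻ b adj) ud≢vd))

-- Case C2

IsPath-bypass : {s t z : Vertex n} {T : List (Vertex n)} →
                IsPath (v ∷ u ∷ s ∷ t ∷ T) v z → Adj v t →
                IsPath (u ∷ s ∷ []) u s × IsPath (v ∷ t ∷ T) v z ×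
                (∀ w → w ∈ u ∷ s ∷ [] → w ∉ v ∷ t ∷ T)
IsPath-bypass {v = v} {u = u} {s = s} {t = t} {T = T}
  (_ ∷ us ∷ _ ∷ linked , ((v≢u ∷ v≢s ∷ v∉) ∷ (u≢s ∷ u∉) ∷ s∉ ∷ unique) , refl , lastZ) vt =
  (us ∷ [-] , (u≢s ∷ []) ∷ [] ∷ [] , refl , refl) ,
  (vt ∷ linked , v∉ ∷ unique , refl , lastZ) ,
  disjoint
  where
  disjoint : ∀ w → w ∈ u ∷ s ∷ [] → w ∉ v ∷ t ∷ T
  disjoint w (here refl)         (here u≡v)  = v≢u (sym u≡v)
  disjoint w (here refl)         (there u∈)  = All¬⇒¬Any u∉ u∈
  disjoint w (there (here refl)) (here s≡v)  = v≢s (sym s≡v)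
  disjoint w (there (here refl)) (there s∈)  = All¬⇒¬Any s∉ s∈

∈-bypass : {s w : Vertex n} {R : List (Vertex n)} →
           w ∈ v ∷ u ∷ s ∷ R → w ∈ u ∷ s ∷ [] ⊎ w ∈ v ∷ R
∈-bypass (here w≡v)                 = inj₂ (here w≡v)
∈-bypass (there (here w≡u))         = inj₁ (here w≡u)
∈-bypass (there (there (here w≡s))) = inj₁ (there (here w≡s))
∈-bypass (there (there (there w∈))) = inj₂ (there w∈)

PathEdge-bypass : {s : Vertex n} {R : List (Vertex n)} → PathEdge (v ∷ u ∷ s ∷ R) x y →
                  x ∉ v ∷ u ∷ s ∷ [] → y ∉ v ∷ u ∷ s ∷ [] → PathEdge (v ∷ R) x y
PathEdge-bypass {v = v} {u} {s = s} edge x∉ y∉ =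
  Sum.map (λ c → there (Consec-++⁻ʳ (v ∷ u ∷ s ∷ []) c x∉))
          (λ c → there (Consec-++⁻ʳ (v ∷ u ∷ s ∷ []) c y∉)) edge

squareHamiltonianPath : {u v : Vertex n} {i j a : Fin n} →
                        u ≡ flipAt v i → Unique (a ∷ j ∷ i ∷ []) →
                        ∃ λ T → let G = v ∷ u ∷ flipAt u j ∷ flipAt v j ∷ T in
                          IsPath G v (flipAt v a) × (∀ w → w ∈ G) × (∀ x → PathEdge G x (flipAt x i))
squareHamiltonianPath {n = n} {u} {v} {i} {j} {a} u≡vⁱ unique =
  T , subst Hamiltonian shape (gray-isPath v (proj₁ ok) , ∈-whole , edges)
  where
  R : List (Fin n)
  R = others (a ∷ j ∷ i ∷ [])
  L : List (Fin n)
  L = a ∷ R ++ j ∷ i ∷ []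
  ok : AllDirectionsExcept [] L
  ok = arrange-allDirectionsExcept [] (a ∷ []) (j ∷ i ∷ []) unique
  T : List (Vertex n)
  T = proj₁ (gray-++ v (a ∷ R) (j ∷ i ∷ []))
  shape : gray v L ≡ v ∷ u ∷ flipAt u j ∷ flipAt v j ∷ T
  shape = trans (proj₂ (gray-++ v (a ∷ R) (j ∷ i ∷ []))) (cong (_++ T) (gray-square u≡vⁱ j))
  Hamiltonian : List (Vertex n) → Set
  Hamiltonian G = IsPath G v (flipAt v a) × (∀ w → w ∈ G) × (∀ x → PathEdge G x (flipAt x i))
  ∈-whole : ∀ w → w ∈ gray v L
  ∈-whole w = ∈-gray⁺ v L λ k k∉L →
    [ (λ k∈L → contradiction k∈L k∉L) , (λ ()) ] (proj₁ (proj₂ ok) k)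
  iLast : (a ∷ R ++ j ∷ []) ++ i ∷ [] ≡ L
  iLast = cong (a ∷_) (++-assoc R (j ∷ []) (i ∷ []))
  edges : ∀ x → PathEdge (gray v L) x (flipAt x i)
  edges x = subst (λ K → PathEdge (gray v K) x (flipAt x i)) iLast
    (gray-pathEdge v (a ∷ R ++ j ∷ []) i (subst (λ K → x ∈ gray v K) (sym iLast) (∈-whole x)))

almostHalfLayer⇒spanningPathPair : {M : EdgeSet n} {u v : Vertex n} →
                                   3 ≤ n → IsMatching M → C2 M u v → SpanningPathPair M u v
almostHalfLayer⇒spanningPathPair {M = M} {u} 3≤n isMatching (i , j , i≢j , refl , A , uuʲ∈M , vvʲ∈M)
  with fresh (j ∷ i ∷ []) (((i≢j ∘ sym) ∷ []) ∷ [] ∷ []) 3≤n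
... | a , unique-aji@((a≢j ∷ a≢i ∷ []) ∷ _)
  with squareHamiltonianPath {v = flipAt u i} (sym (flipAt-involutive u i)) unique-aji
... | T , pathG , ∈G , edgeG with IsPath-bypass pathG (j , refl)
... | pathZu , pathZv , disjoint =
  flipAt u j , flipAt (flipAt u i) a ,
  parity-flipAt-≢ u (flipAt u i) (Adj⇒parity-≢ {x = u} (i , refl)) j a , (j , refl) , (a , refl) ,
  ¬Adj-flipAt-flipAt² u (i≢j ∘ sym) (a≢j ∘ sym) (a≢i ∘ sym) ,
  _ , _ , pathZu , pathZv , disjoint , (λ w → ∈-bypass (∈G w)) , edges
  where
  open Matching isMatching
  Zu : List (Vertex _)
  Zu = u ∷ flipAt u j ∷ []
  Zv : List (Vertex _)
  Zv = flipAt u i ∷ flipAt (flipAt u i) j ∷ T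
  corner : List (Vertex _)
  corner = flipAt u i ∷ u ∷ flipAt u j ∷ []
  matchedAlongJ : x ∈ corner → (x , flipAt x j) ∈E M
  matchedAlongJ (here refl)                 = vvʲ∈M
  matchedAlongJ (there (here refl))         = uuʲ∈M
  matchedAlongJ (there (there (here refl))) = matchedAlong-endpoint uuʲ∈M (inj₂ refl)
  iEdge-avoids : (x , flipAt x i) ∈E M → x ∉ corner
  iEdge-avoids xxⁱ∈M x∈ = flipAt-≢ _ i≢j (M-functional xxⁱ∈M (matchedAlongJ x∈))
  iEdge : (x , flipAt x i) ∈E M → PathEdge Zv x (flipAt x i)
  iEdge {x = x} xxⁱ∈M = PathEdge-bypass (edgeG x) (iEdge-avoids xxⁱ∈M)
    (iEdge-avoids (matchedAlong-endpoint xxⁱ∈M (inj₂ refl)))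
  endpointEdge : (x , y) ∈E M → x ∈ u ∷ flipAt u i ∷ [] → PathEdge Zu x y ⊎ PathEdge Zv x y
  endpointEdge xy∈M (here refl) with M-functional xy∈M uuʲ∈M
  ... | refl = inj₁ (inj₁ here)
  endpointEdge xy∈M (there (here refl)) with M-functional xy∈M vvʲ∈M
  ... | refl = inj₂ (inj₁ here)
  edges : ∀ x y → (x , y) ∈E M → PathEdge Zu x y ⊎ PathEdge Zv x y
  edges x y xy∈M with any? (x ≟ᵥ_) (u ∷ flipAt u i ∷ []) | any? (y ≟ᵥ_) (u ∷ flipAt u i ∷ [])
  ... | yes x∈ | _      = endpointEdge xy∈M x∈
  ... | no _   | yes y∈ = Sum.map Sum.swap Sum.swap (endpointEdge (M-sym xy∈M) y∈)
  ... | no x∉  | no y∉ with almostHalfLayer-edge A xy∈M x∉ y∉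
  ...   | refl = inj₂ (iEdge xy∈M)

-- n ≥ 4 suffices. C1 does not need v to be covered by the half-layer, and in C2 the
-- parities and uv ∉ M are forced by v = u^i and the M-edges at u and v.
lemma7 : (n : ℕ) → 5 ≤ n → (M : EdgeSet n) → IsMatching M →
    (u v : Vertex n) → parity u ≢ parity v → M u v ≡ false →
    (C1 M u v ⊎ C2 M u v) →
    Σ (Vertex n) λ zu → Σ (Vertex n) λ zv →
      parity zu ≢ parity zv × Adj u zu × Adj v zv × ¬ Adj zu zv ×
      Σ (List (Vertex n)) λ Zu → Σ (List (Vertex n)) λ Zv →
        IsPath Zu u zu × IsPath Zv v zv ×
        (∀ w → w ∈ Zu → ¬ (w ∈ Zv)) ×
        (∀ w → w ∈ Zu ⊎ w ∈ Zv) ×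
        (∀ x y → (x , y) ∈E M → PathEdge Zu x y ⊎ PathEdge Zv x y)
lemma7 n 5≤n M isMatching u v pu≢pv uv∉M (inj₁ (i , p , H , u-covered , _)) =
  halfLayer⇒spanningPathPair (<⇒≤ 5≤n) isMatching pu≢pv uv∉M H u-covered
lemma7 n 5≤n M isMatching u v _ _ (inj₂ c2) =
  almostHalfLayer⇒spanningPathPair (<⇒≤ (<⇒≤ 5≤n)) isMatching c2
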